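{- Let $A$ be a Sidon subset of the positive integers, and let $X \subseteq A$ with $|X| \leq \frac12 |A|$ and $|\Sigma^* X| \leq \binom{\frac12 |A|}{2}$. Then there exist $a_1, a_2 \in A \setminus X$ such that $X' = X \cup \{a_1, a_2\}$ satisfies $|\Sigma^* X'| \geq \frac32 |\Sigma^* X|$.
   Context: A set $A$ of integers is a Sidon set if all sums $a_1 + a_2$ ($a_1, a_2 \in A$, $a_1 \le a_2$) are distinct. For $X \subseteq \mathbb{Z}$, $\Sigma^* X = \{\sum_{b \in B} b : B \subseteq X\}$. For non-integer $x$, $\binom{x}{2} = x(x-1)/2$. -}

module Defs where

open import Data.Nat using (ℕ; zero; suc; _+_; _≤_)
open import Data.Nat.Properties using (_≟_)
open import Data.List using (List; []; _∷_; _++_; map; length; deduplicate)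
open import Data.List.Membership.Propositional using (_∈_)
open import Data.Product using (_×_)
open import Relation.Binary.PropositionalEquality using (_≡_)

-- Finite sets of naturals are represented by lists; the set denoted by a
-- list is its set of elements (duplicates and order are irrelevant).

dedup : List ℕ → List ℕ
dedup = deduplicate _≟_

card : List ℕ → ℕ
card xs = length (dedup xs)

_⊆ˢ_ : List ℕ → List ℕ → Set
xs ⊆ˢ ys = ∀ {x} → x ∈ xs → x ∈ ys

subListSums : List ℕ → List ℕ
subListSums [] = 0 ∷ []
subListSums (x ∷ xs) = subListSums xs ++ map (x +_) (subListSums xs)

-- Σ* X = { Σ_{b ∈ B} b : B ⊆ X } (includes the empty sum 0), as a list
-- whose set of elements is Σ* X; sub-sums are taken over the SET X.
Σ* : List ℕ → List ℕ
Σ* X = subListSums (dedup X)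

Sidon : List ℕ → Set
Sidon A = ∀ {a₁ a₂ b₁ b₂} → a₁ ∈ A → a₂ ∈ A → b₁ ∈ A → b₂ ∈ A →
          a₁ ≤ a₂ → b₁ ≤ b₂ → a₁ + a₂ ≡ b₁ + b₂ → (a₁ ≡ b₁ × a₂ ≡ b₂)

Positive : List ℕ → Set
Positive A = ∀ {a} → a ∈ A → 1 ≤ a

{-# OPTIONS --safe #-}

-- Let B = A ∖ X and S = Σ* X with s = |S|; the hypotheses give s ≤ C(|B|, 2). The C(|B|, 2)
-- sums t = a₁ + a₂ of distinct a₁, a₂ ∈ B are positive, and pairwise distinct because A is Sidon.
-- So every pair y < z in S satisfies z = y + t for at most one such t, and summing over t the
-- number of y ∈ S with y + t ∈ S gives at most C(s, 2) < C(|B|, 2) (s + 1) / 2. Hence some t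
-- has at most s / 2 such y, and for it Σ* (X ∪ {a₁, a₂}) ⊇ S ∪ (S + t) has at least 3s / 2 elements.

module Submission where

open import Level using (Level)
open import Data.Nat using (ℕ; zero; suc; _+_; _*_; _∸_; _≤_; _<_; _<?_; _≤?_; z≤n; s≤s; >-nonZero)
open import Data.Nat.Properties
open import Data.Nat.Combinatorics using (_C_; nC1≡n; nCk+nC[k+1]≡[n+1]C[k+1])
open import Data.Nat.ListAction using (sum)
open import Data.Nat.Tactic.RingSolver using (solve-∀)
open import Algebra.Properties.CommutativeSemigroup +-commutativeSemigroup using (interchange)
open import Data.List using (List; []; _∷_; _++_; map; length; filter)
open import Data.List.Properties using (length-++; length-map; map-cong; filter-all; filter-reject)
open import Data.List.Membership.Propositional using (_∈_; _∉_; find)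
open import Data.List.Membership.Propositional.Properties
open import Data.List.Membership.DecPropositional _≟_ using (_∈?_; _∉?_)
open import Data.List.Relation.Unary.Any using (Any; here; there; toSum)
import Data.List.Relation.Unary.All as All
open import Data.List.Relation.Unary.AllPairs using ([]; _∷_)
open import Data.List.Relation.Unary.Unique.Propositional using (Unique)
open import Data.List.Relation.Unary.Unique.Propositional.Properties using (map⁺; ++⁺; filter⁺)
open import Data.List.Relation.Unary.Unique.DecPropositional.Properties _≟_ using (deduplicate-!)
open import Data.Product using (Σ; ∃; ∃₂; _×_; _,_; proj₁; proj₂; map₁)
open import Data.Sum using (_⊎_; inj₁; inj₂; [_,_]′)
open import Function using (_∘_; case_of_)
open import Relation.Binary.PropositionalEquality
open import Relation.Nullary using (Dec; yes; no; ¬_; ¬?)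
open import Relation.Nullary.Negation using (contradiction)
open import Relation.Unary using (Pred; Decidable)
open import Relation.Unary.Properties using (∁?)

open import Defs

private variable
  a b p q r : Level
  A : Set a
  B : Set b

Unique-⊆⇒length≤ : {xs ys : List A} → Unique xs → (∀ {x} → x ∈ xs → x ∈ ys) →
                   length xs ≤ length ys
Unique-⊆⇒length≤ {xs = []} _ _ = z≤n
Unique-⊆⇒length≤ {xs = x ∷ xs} {ys} (x∉xs ∷ xs!) xs⊆ys
  with ys₁ , ys₂ , refl ← ∈-∃++ (xs⊆ys (here refl)) = begin
    suc (length xs)               ≤⟨ s≤s (Unique-⊆⇒length≤ xs! xs⊆ys₁++ys₂) ⟩
    suc (length (ys₁ ++ ys₂))     ≡⟨ cong suc (length-++ ys₁) ⟩
    suc (length ys₁ + length ys₂) ≡⟨ +-suc (length ys₁) (length ys₂) ⟨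
    length ys₁ + length (x ∷ ys₂) ≡⟨ length-++ ys₁ ⟨
    length (ys₁ ++ x ∷ ys₂)       ∎
  where
  open ≤-Reasoning
  xs⊆ys₁++ys₂ : ∀ {y} → y ∈ xs → y ∈ ys₁ ++ ys₂
  xs⊆ys₁++ys₂ y∈xs with ∈-++⁻ ys₁ (xs⊆ys (there y∈xs))
  ... | inj₁ y∈ys₁ = ∈-++⁺ˡ y∈ys₁
  ... | inj₂ (here refl) = contradiction refl (All.lookup x∉xs y∈xs)
  ... | inj₂ (there y∈ys₂) = ∈-++⁺ʳ ys₁ y∈ys₂

count : {P : Pred A p} → Decidable P → List A → ℕ
count P? xs = length (filter P? xs)

𝟙 : {P : Set p} → Dec P → ℕ
𝟙 (yes _) = 1
𝟙 (no _)  = 0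

module _ {P : Pred A p} (P? : Decidable P) where

  count-∷ : ∀ x xs → count P? (x ∷ xs) ≡ 𝟙 (P? x) + count P? xs
  count-∷ x xs with P? x
  ... | yes _ = refl
  ... | no _  = refl

  count≡sum-𝟙 : ∀ xs → count P? xs ≡ sum (map (𝟙 ∘ P?) xs)
  count≡sum-𝟙 []       = refl
  count≡sum-𝟙 (x ∷ xs) = trans (count-∷ x xs) (cong (𝟙 (P? x) +_) (count≡sum-𝟙 xs))

  count+count-∁≡length : ∀ xs → count P? xs + count (∁? P?) xs ≡ length xs
  count+count-∁≡length []       = refl
  count+count-∁≡length (x ∷ xs) with P? x
  ... | yes _ = cong suc (count+count-∁≡length xs)
  ... | no _  = trans (+-suc _ _) (cong suc (count+count-∁≡length xs))

  count-disjoint≤length : {Q : Pred A q} (Q? : Decidable Q) → (∀ {x} → P x → ¬ Q x) →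
                          ∀ xs → count P? xs + count Q? xs ≤ length xs
  count-disjoint≤length Q? P⇒¬Q [] = z≤n
  count-disjoint≤length Q? P⇒¬Q (x ∷ xs) with P? x | Q? x
  ... | yes Px | yes Qx = contradiction Qx (P⇒¬Q Px)
  ... | yes _  | no _   = s≤s (count-disjoint≤length Q? P⇒¬Q xs)
  ... | no _   | yes _  = ≤-trans (≤-reflexive (+-suc _ _)) (s≤s (count-disjoint≤length Q? P⇒¬Q xs))
  ... | no _   | no _   = m≤n⇒m≤1+n (count-disjoint≤length Q? P⇒¬Q xs)

sum-map-+ : (f g : A → ℕ) → ∀ xs →
            sum (map (λ x → f x + g x) xs) ≡ sum (map f xs) + sum (map g xs)
sum-map-+ f g []       = refl
sum-map-+ f g (x ∷ xs) = trans (cong (f x + g x +_) (sum-map-+ f g xs))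
                               (interchange (f x) (g x) (sum (map f xs)) (sum (map g xs)))

sum-map-*ˡ : ∀ k (f : A → ℕ) xs → sum (map (λ x → k * f x) xs) ≡ k * sum (map f xs)
sum-map-*ˡ k f []       = sym (*-zeroʳ k)
sum-map-*ˡ k f (x ∷ xs) = trans (cong (k * f x +_) (sum-map-*ˡ k f xs))
                                (sym (*-distribˡ-+ k (f x) (sum (map f xs))))

sum-map-mono-≤ : {f g : A → ℕ} → (∀ x → f x ≤ g x) → ∀ xs → sum (map f xs) ≤ sum (map g xs)
sum-map-mono-≤ f≤g []       = z≤n
sum-map-mono-≤ f≤g (x ∷ xs) = +-mono-≤ (f≤g x) (sum-map-mono-≤ f≤g xs)

sum-map-const-0 : (xs : List A) → sum (map (λ _ → 0) xs) ≡ 0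
sum-map-const-0 []       = refl
sum-map-const-0 (x ∷ xs) = sum-map-const-0 xs

sum-count-swap : {R : A → B → Set r} (R? : ∀ x y → Dec (R x y)) → ∀ xs ys →
                 sum (map (λ x → count (R? x) ys) xs) ≡ sum (map (λ y → count (λ x → R? x y) xs) ys)
sum-count-swap R? []       ys = sym (sum-map-const-0 ys)
sum-count-swap R? (x ∷ xs) ys = begin
  count (R? x) ys + sum (map (λ x → count (R? x) ys) xs)
    ≡⟨ cong₂ _+_ (count≡sum-𝟙 (R? x) ys) (sum-count-swap R? xs ys) ⟩
  sum (map (λ y → 𝟙 (R? x y)) ys) + sum (map (λ y → count (λ x → R? x y) xs) ys)
    ≡⟨ sum-map-+ (λ y → 𝟙 (R? x y)) (λ y → count (λ x → R? x y) xs) ys ⟨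
  sum (map (λ y → 𝟙 (R? x y) + count (λ x → R? x y) xs) ys)
    ≡⟨ cong sum (map-cong (λ y → count-∷ (λ x → R? x y) x xs) ys) ⟨
  sum (map (λ y → count (λ x → R? x y) (x ∷ xs)) ys) ∎
  where open ≡-Reasoning

averaging : (f : A → ℕ) (k : ℕ) → ∀ xs → sum (map f xs) < length xs * suc k →
            Any (λ x → f x ≤ k) xs
averaging f k []       ()
averaging f k (x ∷ xs) Σf<n[1+k] with f x ≤? k
... | yes fx≤k = here fx≤k
... | no  fx≰k = there (averaging f k xs (+-cancelˡ-< (suc k) _ _
                   (≤-<-trans (+-monoˡ-≤ _ (≰⇒> fx≰k)) Σf<n[1+k])))

[1+n]C2≡n+nC2 : ∀ n → suc n C 2 ≡ n + n C 2
[1+n]C2≡n+nC2 n = trans (sym (nCk+nC[k+1]≡[n+1]C[k+1] n 1)) (cong (_+ n C 2) (nC1≡n n))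

2*nC2≡n*[n∸1] : ∀ n → 2 * (n C 2) ≡ n * (n ∸ 1)
2*nC2≡n*[n∸1] zero    = refl
2*nC2≡n*[n∸1] (suc n) = begin
  2 * (suc n C 2)     ≡⟨ cong (2 *_) ([1+n]C2≡n+nC2 n) ⟩
  2 * (n + n C 2)     ≡⟨ *-distribˡ-+ 2 n (n C 2) ⟩
  2 * n + 2 * (n C 2) ≡⟨ cong (2 * n +_) (2*nC2≡n*[n∸1] n) ⟩
  2 * n + n * (n ∸ 1) ≡⟨ 2*n+n*[n∸1]≡[1+n]*n n ⟩
  suc n * n           ∎
  where
  open ≡-Reasoning
  2*n+n*[n∸1]≡[1+n]*n : ∀ n → 2 * n + n * (n ∸ 1) ≡ suc n * n
  2*n+n*[n∸1]≡[1+n]*n zero    = refl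
  2*n+n*[n∸1]≡[1+n]*n (suc n) = ring n
    where
    ring : ∀ n → 2 * suc n + suc n * n ≡ suc (suc n) * suc n
    ring = solve-∀

n*[n∸1]<n*[1+n] : ∀ {n} → 0 < n → n * (n ∸ 1) < n * suc n
n*[n∸1]<n*[1+n] {n} n>0 = *-monoʳ-< n {{>-nonZero n>0}} (s≤s (m∸n≤m n 1))

2*m≤n⇒n≤m+k⇒n≤2*k : ∀ m n k → 2 * m ≤ n → n ≤ m + k → n ≤ 2 * k
2*m≤n⇒n≤m+k⇒n≤2*k m n k 2m≤n n≤m+k = +-cancelˡ-≤ n n (2 * k) (begin
  n + n             ≤⟨ +-mono-≤ n≤m+k n≤m+k ⟩
  (m + k) + (m + k) ≡⟨ ring m k ⟩
  2 * m + 2 * k     ≤⟨ +-monoˡ-≤ (2 * k) 2m≤n ⟩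
  n + 2 * k         ∎)
  where
  open ≤-Reasoning
  ring : ∀ m k → (m + k) + (m + k) ≡ 2 * m + 2 * k
  ring = solve-∀

8*s≤n*[n∸2]⇒n≤2*m⇒s≤mC2 : ∀ s n m → 8 * s ≤ n * (n ∸ 2) → n ≤ 2 * m → s ≤ m C 2
8*s≤n*[n∸2]⇒n≤2*m⇒s≤mC2 s n m 8s≤n[n∸2] n≤2m = *-cancelˡ-≤ 8 (begin
  8 * s                  ≤⟨ 8s≤n[n∸2] ⟩
  n * (n ∸ 2)            ≤⟨ *-mono-≤ n≤2m (∸-monoˡ-≤ 2 n≤2m) ⟩
  2 * m * (2 * m ∸ 2)    ≡⟨ cong (2 * m *_) (*-distribˡ-∸ 2 m 1) ⟨
  2 * m * (2 * (m ∸ 1))  ≡⟨ ring m (m ∸ 1) ⟩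
  4 * (m * (m ∸ 1))      ≡⟨ cong (4 *_) (2*nC2≡n*[n∸1] m) ⟨
  4 * (2 * (m C 2))      ≡⟨ *-assoc 4 2 (m C 2) ⟨
  8 * (m C 2)            ∎)
  where
  open ≤-Reasoning
  ring : ∀ a b → 2 * a * (2 * b) ≡ 4 * (a * b)
  ring = solve-∀

c+e≡s⇒2*c≤s⇒s+e≤k⇒3*s≤2*k : ∀ {c e s k} → c + e ≡ s → 2 * c ≤ s → s + e ≤ k → 3 * s ≤ 2 * k
c+e≡s⇒2*c≤s⇒s+e≤k⇒3*s≤2*k {c} {e} {k = k} refl 2c≤s s+e≤k = begin
  3 * (c + e)           ≡⟨ ring c e ⟩
  2 * (c + e) + (c + e) ≤⟨ +-monoʳ-≤ (2 * (c + e)) (+-monoˡ-≤ e c≤e) ⟩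
  2 * (c + e) + (e + e) ≡⟨ ring′ (c + e) e ⟩
  2 * ((c + e) + e)     ≤⟨ *-monoʳ-≤ 2 s+e≤k ⟩
  2 * k                 ∎
  where
  open ≤-Reasoning
  ring : ∀ c e → 3 * (c + e) ≡ 2 * (c + e) + (c + e)
  ring = solve-∀
  ring′ : ∀ s e → 2 * s + (e + e) ≡ 2 * (s + e)
  ring′ = solve-∀
  c≤e : c ≤ e
  c≤e = +-cancelˡ-≤ c c e (subst (_≤ c + e) (cong (c +_) (+-identityʳ c)) 2c≤s)

pairSums : List ℕ → List ℕ
pairSums []       = []
pairSums (x ∷ xs) = map (x +_) xs ++ pairSums xs

length-pairSums : ∀ xs → length (pairSums xs) ≡ length xs C 2
length-pairSums []       = refl
length-pairSums (x ∷ xs) = begin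
  length (map (x +_) xs ++ pairSums xs)         ≡⟨ length-++ (map (x +_) xs) ⟩
  length (map (x +_) xs) + length (pairSums xs) ≡⟨ cong₂ _+_ (length-map (x +_) xs) (length-pairSums xs) ⟩
  length xs + length xs C 2                     ≡⟨ [1+n]C2≡n+nC2 (length xs) ⟨
  suc (length xs) C 2                           ∎
  where open ≡-Reasoning

∈-pairSums⁻ : ∀ {xs t} → Unique xs → t ∈ pairSums xs →
              ∃₂ λ a b → a ∈ xs × b ∈ xs × a ≢ b × t ≡ a + b
∈-pairSums⁻ {x ∷ xs} (x∉xs ∷ xs!) t∈ with ∈-++⁻ (map (x +_) xs) t∈
... | inj₁ t∈x+xs with b , b∈xs , refl ← ∈-map⁻ (x +_) t∈x+xs =
  x , b , here refl , there b∈xs , All.lookup x∉xs b∈xs , refl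
... | inj₂ t∈pairSums with a , b , a∈xs , b∈xs , a≢b , refl ← ∈-pairSums⁻ xs! t∈pairSums =
  a , b , there a∈xs , there b∈xs , a≢b , refl

Sidon-⊆ : ∀ {A B} → B ⊆ˢ A → Sidon A → Sidon B
Sidon-⊆ B⊆A sidon a₁∈B a₂∈B b₁∈B b₂∈B = sidon (B⊆A a₁∈B) (B⊆A a₂∈B) (B⊆A b₁∈B) (B⊆A b₂∈B)

Positive-⊆ : ∀ {A B} → B ⊆ˢ A → Positive A → Positive B
Positive-⊆ B⊆A positive = positive ∘ B⊆A

Sidon⇒summand-unique : ∀ {A} → Sidon A → ∀ {a b c d} → a ∈ A → b ∈ A → c ∈ A → d ∈ A →
                        a + b ≡ c + d → a ≡ c ⊎ a ≡ d
Sidon⇒summand-unique sidon {a} {b} {c} {d} a∈ b∈ c∈ d∈ eq with ≤-total a b | ≤-total c d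
... | inj₁ a≤b | inj₁ c≤d = inj₁ (proj₁ (sidon a∈ b∈ c∈ d∈ a≤b c≤d eq))
... | inj₁ a≤b | inj₂ d≤c = inj₂ (proj₁ (sidon a∈ b∈ d∈ c∈ a≤b d≤c (trans eq (+-comm c d))))
... | inj₂ b≤a | inj₁ c≤d = inj₂ (proj₂ (sidon b∈ a∈ c∈ d∈ b≤a c≤d (trans (+-comm b a) eq)))
... | inj₂ b≤a | inj₂ d≤c =
  inj₁ (proj₂ (sidon b∈ a∈ d∈ c∈ b≤a d≤c (trans (+-comm b a) (trans eq (+-comm c d)))))

Sidon⇒Unique-pairSums : ∀ {xs} → Sidon xs → Unique xs → Unique (pairSums xs)
Sidon⇒Unique-pairSums {[]}     sidon []          = []
Sidon⇒Unique-pairSums {x ∷ xs} sidon (x∉xs ∷ xs!) =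
  ++⁺ (map⁺ (+-cancelˡ-≡ x _ _) xs!) (Sidon⇒Unique-pairSums (Sidon-⊆ there sidon) xs!) disjoint
  where
  disjoint : ∀ {t} → ¬ (t ∈ map (x +_) xs × t ∈ pairSums xs)
  disjoint (t∈x+xs , t∈pairSums)
    with b , b∈xs , refl ← ∈-map⁻ (x +_) t∈x+xs
       | c , d , c∈xs , d∈xs , _ , eq ← ∈-pairSums⁻ xs! t∈pairSums
    with Sidon⇒summand-unique sidon (here refl) (there b∈xs) (there c∈xs) (there d∈xs) eq
  ... | inj₁ refl = All.lookup x∉xs c∈xs refl
  ... | inj₂ refl = All.lookup x∉xs d∈xs refl

sum-count-greater≤C2 : ∀ xs → sum (map (λ y → count (y <?_) xs) xs) ≤ length xs C 2
sum-count-greater≤C2 []       = z≤n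
sum-count-greater≤C2 (x ∷ xs) = begin
  count (x <?_) (x ∷ xs) + sum (map (λ y → count (y <?_) (x ∷ xs)) xs)
    ≡⟨ cong₂ _+_ (cong length (filter-reject (x <?_) (<-irrefl refl)))
                 (cong sum (map-cong (λ y → count-∷ (y <?_) x xs) xs)) ⟩
  count (x <?_) xs + sum (map (λ y → 𝟙 (y <? x) + count (y <?_) xs) xs)
    ≡⟨ cong (count (x <?_) xs +_) (sum-map-+ (λ y → 𝟙 (y <? x)) (λ y → count (y <?_) xs) xs) ⟩
  count (x <?_) xs + (sum (map (λ y → 𝟙 (y <? x)) xs) + sum (map (λ y → count (y <?_) xs) xs))
    ≡⟨ cong (λ n → count (x <?_) xs + (n + _)) (count≡sum-𝟙 (_<? x) xs) ⟨
  count (x <?_) xs + (count (_<? x) xs + sum (map (λ y → count (y <?_) xs) xs))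
    ≡⟨ +-assoc (count (x <?_) xs) _ _ ⟨
  count (x <?_) xs + count (_<? x) xs + sum (map (λ y → count (y <?_) xs) xs)
    ≤⟨ +-mono-≤ (count-disjoint≤length (x <?_) (_<? x) <-asym xs) (sum-count-greater≤C2 xs) ⟩
  length xs + length xs C 2
    ≡⟨ [1+n]C2≡n+nC2 (length xs) ⟨
  suc (length xs) C 2 ∎
  where open ≤-Reasoning

count-shift≤count-greater : ∀ {ts} → Unique ts → (∀ {t} → t ∈ ts → 0 < t) → ∀ S y →
                            count (λ t → y + t ∈? S) ts ≤ count (y <?_) S
count-shift≤count-greater {ts} ts! ts>0 S y =
  subst (_≤ count (y <?_) S) (length-map (y +_) (filter (λ t → y + t ∈? S) ts))
        (Unique-⊆⇒length≤ (map⁺ (+-cancelˡ-≡ y _ _) (filter⁺ (λ t → y + t ∈? S) ts!)) shifted⊆)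
  where
  shifted⊆ : ∀ {z} → z ∈ map (y +_) (filter (λ t → y + t ∈? S) ts) → z ∈ filter (y <?_) S
  shifted⊆ z∈ with t , t∈ , refl ← ∈-map⁻ (y +_) z∈
                 with t∈ts , y+t∈S ← ∈-filter⁻ (λ t → y + t ∈? S) t∈ =
    ∈-filter⁺ (y <?_) y+t∈S (m<m+n y (ts>0 t∈ts))

collisions : List ℕ → ℕ → ℕ
collisions S t = count (λ y → y + t ∈? S) S

some-pairSum-shift-has-few-collisions :
  ∀ {B S} → Sidon B → Positive B → Unique B → Unique S → 0 < length S → length S ≤ length B C 2 →
  ∃₂ λ a₁ a₂ → a₁ ∈ B × a₂ ∈ B × a₁ ≢ a₂ × 2 * collisions S (a₁ + a₂) ≤ length S
some-pairSum-shift-has-few-collisions {B} {S} sidon positive B! S! s>0 s≤|B|C2 =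
  split (find (averaging (λ t → 2 * collisions S t) s T Σ2*collisions<|T|[1+s]))
  where
  open ≤-Reasoning
  T = pairSums B
  s = length S

  split : (∃ λ t → t ∈ T × 2 * collisions S t ≤ s) →
          ∃₂ λ a₁ a₂ → a₁ ∈ B × a₂ ∈ B × a₁ ≢ a₂ × 2 * collisions S (a₁ + a₂) ≤ s
  split (t , t∈T , 2*collisions≤s) with a₁ , a₂ , a₁∈B , a₂∈B , a₁≢a₂ , refl ← ∈-pairSums⁻ B! t∈T =
    a₁ , a₂ , a₁∈B , a₂∈B , a₁≢a₂ , 2*collisions≤s

  T>0 : ∀ {t} → t ∈ T → 0 < t
  T>0 t∈T with a , b , a∈B , _ , _ , refl ← ∈-pairSums⁻ B! t∈T = ≤-trans (positive a∈B) (m≤m+n a b)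

  Σcollisions≤sC2 : sum (map (collisions S) T) ≤ s C 2
  Σcollisions≤sC2 = begin
    sum (map (collisions S) T)                        ≡⟨ sum-count-swap (λ t y → y + t ∈? S) T S ⟩
    sum (map (λ y → count (λ t → y + t ∈? S) T) S)
      ≤⟨ sum-map-mono-≤ (count-shift≤count-greater (Sidon⇒Unique-pairSums sidon B!) T>0 S) S ⟩
    sum (map (λ y → count (y <?_) S) S)               ≤⟨ sum-count-greater≤C2 S ⟩
    s C 2                                             ∎

  Σ2*collisions<|T|[1+s] : sum (map (λ t → 2 * collisions S t) T) < length T * suc s
  Σ2*collisions<|T|[1+s] = begin-strict
    sum (map (λ t → 2 * collisions S t) T) ≡⟨ sum-map-*ˡ 2 (collisions S) T ⟩
    2 * sum (map (collisions S) T)         ≤⟨ *-monoʳ-≤ 2 Σcollisions≤sC2 ⟩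
    2 * (s C 2)                            ≡⟨ 2*nC2≡n*[n∸1] s ⟩
    s * (s ∸ 1)                            <⟨ n*[n∸1]<n*[1+n] s>0 ⟩
    s * suc s                              ≤⟨ *-monoˡ-≤ (suc s) s≤|B|C2 ⟩
    (length B C 2) * suc s                 ≡⟨ cong (_* suc s) (length-pairSums B) ⟨
    length T * suc s                       ∎

length+count-shift-escapes≤card : ∀ {S M} t → Unique S → (∀ {y} → y ∈ S → y ∈ M) →
                                   (∀ {y} → y ∈ S → y + t ∈ M) →
                                   length S + count (λ y → y + t ∉? S) S ≤ card M
length+count-shift-escapes≤card {S} {M} t S! S⊆M S+t⊆M =
  subst (_≤ card M) length-S∪escapes (Unique-⊆⇒length≤ S∪escapes! S∪escapes⊆M)
  where
  escapes = filter (λ y → y + t ∉? S) S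
  S∪escapes = S ++ map (_+ t) escapes

  length-S∪escapes : length S∪escapes ≡ length S + count (λ y → y + t ∉? S) S
  length-S∪escapes = trans (length-++ S) (cong (length S +_) (length-map (_+ t) escapes))

  disjoint : ∀ {z} → ¬ (z ∈ S × z ∈ map (_+ t) escapes)
  disjoint (z∈S , z∈) with y , y∈ , refl ← ∈-map⁻ (_+ t) z∈ =
    proj₂ (∈-filter⁻ (λ y → y + t ∉? S) {xs = S} y∈) z∈S

  S∪escapes! : Unique S∪escapes
  S∪escapes! = ++⁺ S! (map⁺ (+-cancelʳ-≡ t _ _) (filter⁺ (λ y → y + t ∉? S) S!)) disjoint

  S∪escapes⊆M : ∀ {z} → z ∈ S∪escapes → z ∈ dedup M
  S∪escapes⊆M z∈ with ∈-++⁻ S z∈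
  ... | inj₁ z∈S = ∈-deduplicate⁺ _≟_ (S⊆M z∈S)
  ... | inj₂ z∈ with y , y∈ , refl ← ∈-map⁻ (_+ t) z∈ =
    ∈-deduplicate⁺ _≟_ (S+t⊆M (proj₁ (∈-filter⁻ (λ y → y + t ∉? S) {xs = S} y∈)))

_∖_ : List ℕ → List ℕ → List ℕ
A ∖ X = filter (_∉? X) (dedup A)

∈-∖⁻ : ∀ A X {a} → a ∈ A ∖ X → a ∈ A × a ∉ X
∈-∖⁻ A X = map₁ (∈-deduplicate⁻ _≟_ A) ∘ ∈-filter⁻ (_∉? X) {xs = dedup A}

∖-⊆ : ∀ A X → (A ∖ X) ⊆ˢ A
∖-⊆ A X = proj₁ ∘ ∈-∖⁻ A X

Unique-∖ : ∀ A X → Unique (A ∖ X)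
Unique-∖ A X = filter⁺ (_∉? X) (deduplicate-! A)

card≤card+length∖ : ∀ A X → card A ≤ card X + length (A ∖ X)
card≤card+length∖ A X = begin
  card A                                   ≡⟨ count+count-∁≡length (_∈? X) (dedup A) ⟨
  count (_∈? X) (dedup A) + length (A ∖ X) ≤⟨ +-monoˡ-≤ _ A∩X≤X ⟩
  card X + length (A ∖ X)                  ∎
  where
  open ≤-Reasoning
  A∩X≤X : count (_∈? X) (dedup A) ≤ card X
  A∩X≤X = Unique-⊆⇒length≤ (filter⁺ (_∈? X) (deduplicate-! A))
            (∈-deduplicate⁺ _≟_ ∘ proj₂ ∘ ∈-filter⁻ (_∈? X) {xs = dedup A})

s≤length∖C2 : ∀ A X {s} → 2 * card X ≤ card A → 8 * s ≤ card A * (card A ∸ 2) →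
              s ≤ length (A ∖ X) C 2
s≤length∖C2 A X {s} 2|X|≤|A| 8s≤|A|[|A|∸2] =
  8*s≤n*[n∸2]⇒n≤2*m⇒s≤mC2 s (card A) (length (A ∖ X)) 8s≤|A|[|A|∸2]
    (2*m≤n⇒n≤m+k⇒n≤2*k (card X) (card A) (length (A ∖ X)) 2|X|≤|A| (card≤card+length∖ A X))

dedup-∷-∉ : ∀ {x xs} → x ∉ xs → dedup (x ∷ xs) ≡ x ∷ dedup xs
dedup-∷-∉ {x} {xs} x∉xs = cong (x ∷_) (filter-all (¬? ∘ (x ≟_)) (All.tabulate x≢dedup))
  where
  x≢dedup : ∀ {y} → y ∈ dedup xs → x ≢ y
  x≢dedup y∈ refl = x∉xs (∈-deduplicate⁻ _≟_ xs y∈)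

0∈subListSums : ∀ xs → 0 ∈ subListSums xs
0∈subListSums []       = here refl
0∈subListSums (x ∷ xs) = ∈-++⁺ˡ (0∈subListSums xs)

∈-subListSums-∷ : ∀ x xs {y} → y ∈ subListSums xs → y ∈ subListSums (x ∷ xs)
∈-subListSums-∷ x xs = ∈-++⁺ˡ

+-∈-subListSums-∷ : ∀ x xs {y} → y ∈ subListSums xs → x + y ∈ subListSums (x ∷ xs)
+-∈-subListSums-∷ x xs y∈ = ∈-++⁺ʳ (subListSums xs) (∈-map⁺ (x +_) y∈)

0<card-Σ* : ∀ X → 0 < card (Σ* X)
0<card-Σ* X = ∈-length (∈-deduplicate⁺ _≟_ (0∈subListSums (dedup X)))

module _ {a₁ a₂ : ℕ} {X : List ℕ} (a₁≢a₂ : a₁ ≢ a₂) (a₁∉X : a₁ ∉ X) (a₂∉X : a₂ ∉ X) where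

  private
    Σ*-∷-∷ : Σ* (a₁ ∷ a₂ ∷ X) ≡ subListSums (a₁ ∷ a₂ ∷ dedup X)
    Σ*-∷-∷ = cong subListSums (begin
      dedup (a₁ ∷ a₂ ∷ X) ≡⟨ dedup-∷-∉ ([ a₁≢a₂ , a₁∉X ]′ ∘ toSum) ⟩
      a₁ ∷ dedup (a₂ ∷ X) ≡⟨ cong (a₁ ∷_) (dedup-∷-∉ a₂∉X) ⟩
      a₁ ∷ a₂ ∷ dedup X   ∎)
      where open ≡-Reasoning

  ∈-Σ*-∷-∷ : ∀ {y} → y ∈ Σ* X → y ∈ Σ* (a₁ ∷ a₂ ∷ X)
  ∈-Σ*-∷-∷ y∈ = subst (_ ∈_) (sym Σ*-∷-∷)
    (∈-subListSums-∷ a₁ (a₂ ∷ dedup X) (∈-subListSums-∷ a₂ (dedup X) y∈))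

  +-∈-Σ*-∷-∷ : ∀ {y} → y ∈ Σ* X → y + (a₁ + a₂) ∈ Σ* (a₁ ∷ a₂ ∷ X)
  +-∈-Σ*-∷-∷ {y} y∈ = subst₂ _∈_ (trans (sym (+-assoc a₁ a₂ y)) (+-comm (a₁ + a₂) y)) (sym Σ*-∷-∷)
    (+-∈-subListSums-∷ a₁ (a₂ ∷ dedup X) (+-∈-subListSums-∷ a₂ (dedup X) y∈))

  3*card-Σ*≤2*card-Σ*-∷-∷ : 2 * collisions (dedup (Σ* X)) (a₁ + a₂) ≤ card (Σ* X) →
                            3 * card (Σ* X) ≤ 2 * card (Σ* (a₁ ∷ a₂ ∷ X))
  3*card-Σ*≤2*card-Σ*-∷-∷ few-collisions =
    c+e≡s⇒2*c≤s⇒s+e≤k⇒3*s≤2*k (count+count-∁≡length (λ y → y + (a₁ + a₂) ∈? S) S) few-collisions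
      (length+count-shift-escapes≤card (a₁ + a₂) (deduplicate-! (Σ* X))
        (∈-Σ*-∷-∷ ∘ ∈-deduplicate⁻ _≟_ (Σ* X)) (+-∈-Σ*-∷-∷ ∘ ∈-deduplicate⁻ _≟_ (Σ* X)))
    where
    S = dedup (Σ* X)

lemma5 : (A X : List ℕ) → Positive A → Sidon A → X ⊆ˢ A →
         2 * card X ≤ card A →
         8 * card (Σ* X) ≤ card A * (card A ∸ 2) →
         Σ ℕ λ a₁ → Σ ℕ λ a₂ →
           (a₁ ∈ A × a₁ ∉ X) × (a₂ ∈ A × a₂ ∉ X) ×
           (3 * card (Σ* X) ≤ 2 * card (Σ* (a₁ ∷ a₂ ∷ X)))
lemma5 A X positive sidon _ 2|X|≤|A| 8|Σ*X|≤|A|[|A|∸2] =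
  case some-pairSum-shift-has-few-collisions (Sidon-⊆ (∖-⊆ A X) sidon) (Positive-⊆ (∖-⊆ A X) positive)
         (Unique-∖ A X) (deduplicate-! (Σ* X)) (0<card-Σ* X)
         (s≤length∖C2 A X 2|X|≤|A| 8|Σ*X|≤|A|[|A|∸2]) of λ
    (a₁ , a₂ , a₁∈A∖X , a₂∈A∖X , a₁≢a₂ , few-collisions) →
      a₁ , a₂ , ∈-∖⁻ A X a₁∈A∖X , ∈-∖⁻ A X a₂∈A∖X ,
      3*card-Σ*≤2*card-Σ*-∷-∷ a₁≢a₂ (proj₂ (∈-∖⁻ A X a₁∈A∖X)) (proj₂ (∈-∖⁻ A X a₂∈A∖X)) few-collisions
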